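{- Let $G$ be a graph containing no subgraph isomorphic to $C_6$, let $x\in V(G)$, let $A$ be a connected component of $G[N_2(x)]$ all of whose vertices belong to $V(H_x)$, and let $a,b$ be two adjacent vertices of $A$. Then: (1) $N(x)\cap N(V(A))=N(x)\cap N(\{a,b\})$; (2) $(N(a)\setminus N(b))\cap N(x)\neq\emptyset$; (3) $(N(b)\setminus N(a))\cap N(x)\neq\emptyset$; (4) $N(a)\cap N(b)\cap N(x)=\emptyset$.
   Context: Graphs are finite, simple, undirected; all neighborhoods are taken in $G$. For a nonempty set $S$ of vertices, $N(S)$ (resp. $N[S]$) is the set of vertices at distance exactly $1$ (resp. at most $1$) from $S$; $N(v)=N(\{v\})$; $N_2(x)$ (resp. $N_2[x]$) is the set of vertices at distance exactly $2$ (resp. at most $2$) from $x$; $N[\emptyset]=\emptyset$. "No subgraph isomorphic to $C_6$" refers to not necessarily induced subgraphs. Let $A^*$ be the set of all connected components $A'$ of $G[N_2(x)]$ for which there exists a vertex $a'\in V(A')$ with $N(x)\cap N(a')=N(x)\cap N(V(A'))$, let $V(A^*)$ be the union of the vertex sets of the components in $A^*$, and let $H_x=G[N_2[x]\setminus N[V(A^*)]]$. -}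

module Defs where

open import Level using (0ℓ)
open import Data.Nat using (ℕ)
open import Data.Fin using (Fin; zero; suc)
open import Data.Product using (_×_; ∃; ∃-syntax)
open import Data.Sum using (_⊎_)
open import Data.Empty using (⊥)
open import Relation.Nullary using (¬_)
open import Relation.Binary using (Decidable)
open import Relation.Binary.PropositionalEquality using (_≡_; _≢_)
open import Relation.Unary using (Pred; _∈_; _∉_; _∩_; _∪_; ∁; _≐_; ｛_｝)
open import Function.Definitions using (Injective)

record Graph (n : ℕ) : Set₁ where
  field
    Adj    : Fin n → Fin n → Set
    adj?   : Decidable Adj
    sym    : ∀ {u v} → Adj u v → Adj v u
    irrefl : ∀ {u} → ¬ Adj u u

module _ {n : ℕ} (G : Graph n) where
  open Graph G

  V : Set
  V = Fin n

  N : V → Pred V 0ℓ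
  N v u = Adj v u

  NS : Pred V 0ℓ → Pred V 0ℓ
  NS S u = u ∉ S × ∃[ s ] (s ∈ S × Adj s u)

  NSc : Pred V 0ℓ → Pred V 0ℓ
  NSc S u = u ∈ S ⊎ ∃[ s ] (s ∈ S × Adj s u)

  N₂ : V → Pred V 0ℓ
  N₂ x u = u ≢ x × ¬ Adj x u × ∃[ w ] (Adj x w × Adj w u)

  N₂c : V → Pred V 0ℓ
  N₂c x u = u ≡ x ⊎ Adj x u ⊎ N₂ x u

  data WalkIn (S : Pred V 0ℓ) : V → V → Set where
    here : ∀ {v} → v ∈ S → WalkIn S v v
    step : ∀ {v w u} → v ∈ S → Adj v w → WalkIn S w u → WalkIn S v u

  Comp : Pred V 0ℓ → V → Pred V 0ℓ
  Comp S r u = WalkIn S r u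

  -- Component (with representative r) of G[N₂(x)] belongs to A*.
  InAstar : V → V → Set
  InAstar x r = r ∈ N₂ x ×
    ∃[ a' ] (a' ∈ Comp (N₂ x) r × ((N x ∩ N a') ≐ (N x ∩ NS (Comp (N₂ x) r))))

  VAstar : V → Pred V 0ℓ
  VAstar x v = ∃[ r ] (InAstar x r × v ∈ Comp (N₂ x) r)

  VH : V → Pred V 0ℓ
  VH x = N₂c x ∩ ∁ (NSc (VAstar x))

  -- G contains a (not necessarily induced) 6-cycle.
  next6 : Fin 6 → Fin 6
  next6 zero = suc zero
  next6 (suc zero) = suc (suc zero)
  next6 (suc (suc zero)) = suc (suc (suc zero))
  next6 (suc (suc (suc zero))) = suc (suc (suc (suc zero)))
  next6 (suc (suc (suc (suc zero)))) = suc (suc (suc (suc (suc zero))))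
  next6 (suc (suc (suc (suc (suc zero))))) = zero

  HasC6 : Set
  HasC6 = ∃[ f ] (Injective _≡_ _≡_ f × (∀ (i : Fin 6) → Adj (f i) (f (next6 i))))

  C6Free : Set
  C6Free = ¬ HasC6

module Submission where

-- The whole argument rests on one transfer principle: if
-- p − q − y is a path inside N₂(x), then every neighbour of y in N(x) is a
-- neighbour of p, for otherwise x, w, p, q, y, u (w a neighbour of p in N(x))
-- would be a 6-cycle.  Walking from the edge a−b to any vertex c of A and
-- applying the principle at each step shows N(x) ∩ N(c) ⊆ N(a) ∪ N(b), which
-- is part (1).  If N(x) ∩ N(a) ⊆ N(b), part (1) makes b a witness that A
-- belongs to A*, contradicting that A lies in H_x; decidability of adjacency
-- turns this into a vertex of (N(a) ∖ N(b)) ∩ N(x), which is part (2), and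
-- part (3) by symmetry.  Finally a common neighbour w of a and b in N(x),
-- together with the private neighbours u, u′ from (2) and (3), would close the
-- 6-cycle x, u, a, w, b, u′, giving part (4).

open import Defs
open import Data.Nat using (ℕ)
open import Data.Fin using (zero; suc; _≟_)
open import Data.Fin.Properties using (¬∀⟶∃¬)
open import Data.Vec using (_∷_; []; lookup)
open import Data.Vec.Relation.Unary.Unique.Propositional using (Unique)
open import Data.Vec.Relation.Unary.Unique.Propositional.Properties using (lookup-injective)
open import Data.Vec.Relation.Unary.AllPairs using (_∷_; [])
open import Data.Vec.Relation.Unary.All using (_∷_; [])
open import Data.Product using (_×_; _,_; proj₁; proj₂; ∃-syntax)
open import Data.Sum using (inj₁; inj₂)
open import Relation.Nullary using (¬_; yes; no; contradiction)
open import Relation.Nullary.Decidable using (_→-dec_; decidable-stable)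
open import Relation.Binary.PropositionalEquality using (_≢_; refl; ≢-sym)
open import Relation.Unary using (_∈_; _∩_; _∪_; ∁; _⊆_; _≐_; Satisfiable; Empty; ｛_｝)

module _ {n : ℕ} (G : Graph n) where
  open Graph G renaming (sym to adj-sym)

  adj⇒≢ : ∀ {u v} → Adj u v → u ≢ v
  adj⇒≢ uv refl = irrefl uv

  walk-target : ∀ {S v u} → WalkIn G S v u → u ∈ S
  walk-target (here u∈S)      = u∈S
  walk-target (step _ _ rest) = walk-target rest

  walk-source : ∀ {S v u} → WalkIn G S v u → v ∈ S
  walk-source (here v∈S)     = v∈S
  walk-source (step v∈S _ _) = v∈S

  _++ʷ_ : ∀ {S v w u} → WalkIn G S v w → WalkIn G S w u → WalkIn G S v u
  here _           ++ʷ q = q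
  step v∈S vw rest ++ʷ q = step v∈S vw (rest ++ʷ q)

  reverseʷ : ∀ {S v u} → WalkIn G S v u → WalkIn G S u v
  reverseʷ (here v∈S)         = here v∈S
  reverseʷ (step v∈S vw rest) =
    reverseʷ rest ++ʷ step (walk-source rest) (adj-sym vw) (here v∈S)

  comp-walk : ∀ {S r a c} → a ∈ Comp G S r → c ∈ Comp G S r → WalkIn G S a c
  comp-walk r⇝a r⇝c = reverseʷ r⇝a ++ʷ r⇝c

  -- Six vertices joined cyclically by edges form a C₆ as soon as the
  -- non-consecutive ones are distinct (consecutive ones are, by adj⇒≢).
  six-cycle : ∀ {v₀ v₁ v₂ v₃ v₄ v₅} →
    Adj v₀ v₁ → Adj v₁ v₂ → Adj v₂ v₃ → Adj v₃ v₄ → Adj v₄ v₅ → Adj v₅ v₀ →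
    v₀ ≢ v₂ → v₀ ≢ v₃ → v₀ ≢ v₄ → v₁ ≢ v₃ → v₁ ≢ v₄ → v₁ ≢ v₅ →
    v₂ ≢ v₄ → v₂ ≢ v₅ → v₃ ≢ v₅ → HasC6 G
  six-cycle {v₀} {v₁} {v₂} {v₃} {v₄} {v₅} e₀ e₁ e₂ e₃ e₄ e₅
            d₀₂ d₀₃ d₀₄ d₁₃ d₁₄ d₁₅ d₂₄ d₂₅ d₃₅ =
    lookup cycle , (λ {i} {j} → lookup-injective distinct i j) , edges
    where
    cycle = v₀ ∷ v₁ ∷ v₂ ∷ v₃ ∷ v₄ ∷ v₅ ∷ []

    distinct : Unique cycle
    distinct = (adj⇒≢ e₀ ∷ d₀₂ ∷ d₀₃ ∷ d₀₄ ∷ ≢-sym (adj⇒≢ e₅) ∷ [])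
             ∷ (adj⇒≢ e₁ ∷ d₁₃ ∷ d₁₄ ∷ d₁₅ ∷ [])
             ∷ (adj⇒≢ e₂ ∷ d₂₄ ∷ d₂₅ ∷ [])
             ∷ (adj⇒≢ e₃ ∷ d₃₅ ∷ [])
             ∷ (adj⇒≢ e₄ ∷ [])
             ∷ []
             ∷ []

    edges : ∀ i → Adj (lookup cycle i) (lookup cycle (next6 G i))
    edges zero                               = e₀
    edges (suc zero)                         = e₁
    edges (suc (suc zero))                   = e₂
    edges (suc (suc (suc zero)))             = e₃
    edges (suc (suc (suc (suc zero))))       = e₄
    edges (suc (suc (suc (suc (suc zero))))) = e₅

  module _ (x : V G) where

    N₂-≢-root : ∀ {p} → p ∈ N₂ G x → p ≢ x
    N₂-≢-root = proj₁

    N₂-≢-N : ∀ {p u} → p ∈ N₂ G x → u ∈ N G x → p ≢ u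
    N₂-≢-N (_ , x≁p , _) xu refl = x≁p xu

    attach : ∀ {S u} → S ⊆ N₂ G x → u ∈ N G x →
             ∃[ s ] (s ∈ S × Adj s u) → u ∈ N G x ∩ NS G S
    attach S⊆N₂ xu su = xu , (λ u∈S → N₂-≢-N (S⊆N₂ u∈S) xu refl) , su

    -- If N(x) ∩ N(a) ⊈ N(b) then a has a neighbour in N(x) ∖ N(b); adjacency
    -- is decidable and G is finite, so the failure has a witness.
    private-neighbour : ∀ {a b} → ¬ (N G x ∩ N G a ⊆ N G b) →
                        Satisfiable ((N G a ∩ ∁ (N G b)) ∩ N G x)
    private-neighbour {a} {b} ¬incl
      with ¬∀⟶∃¬ n _ (λ u → adj? x u →-dec (adj? a u →-dec adj? b u))
                     (λ incl → ¬incl (λ {u} (xu , au) → incl u xu au))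
    ... | u , ¬impl =
      u , (au , λ bu → ¬impl (λ _ _ → bu)) , xu
      where
      xu : Adj x u
      xu = decidable-stable (adj? x u) (λ x≁u → ¬impl (λ xu → contradiction xu x≁u))
      au : Adj a u
      au = decidable-stable (adj? a u) (λ a≁u → ¬impl (λ _ au → contradiction au a≁u))

  module _ (c6-free : C6Free G) (x : V G) where

    -- Transfer principle: along a path p − q − y in N₂(x), every neighbour of y
    -- in N(x) is a neighbour of p.  Otherwise, for a neighbour w of p in N(x),
    -- the walk x, w, p, q, y, u is a 6-cycle.
    transfer : ∀ {p q y u} → p ∈ N₂ G x → q ∈ N₂ G x → y ∈ N₂ G x →
               Adj p q → Adj q y → Adj x u → Adj y u → Adj p u
    transfer {p} {q} {y} {u} p₂ q₂ y₂ pq qy xu yu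
      with y ≟ p | proj₂ (proj₂ p₂)
    ... | yes refl | _ = yu
    ... | no y≢p | w , xw , wp with w ≟ u
    ...   | yes refl = adj-sym wp
    ...   | no w≢u = contradiction
      (six-cycle xw wp pq qy yu (adj-sym xu)
         (≢-sym (N₂-≢-root x p₂)) (≢-sym (N₂-≢-root x q₂)) (≢-sym (N₂-≢-root x y₂))
         (≢-sym (N₂-≢-N x q₂ xw)) (≢-sym (N₂-≢-N x y₂ xw)) w≢u
         (≢-sym y≢p) (N₂-≢-N x p₂ xu) (N₂-≢-N x q₂ xu))
      c6-free

    -- Induction on the walk,
    -- moving the edge one step forward with the transfer principle.
    cover : ∀ {p q c} → p ∈ N₂ G x → Adj p q → WalkIn G (N₂ G x) q c →
            N G x ∩ N G c ⊆ N G p ∪ N G q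
    cover p₂ pq (here _) (_ , cu) = inj₂ cu
    cover p₂ pq (step q₂ qy rest) (xu , cu) with cover q₂ qy rest (xu , cu)
    ... | inj₁ qu = inj₂ qu
    ... | inj₂ yu = inj₁ (transfer p₂ q₂ (walk-source rest) pq qy xu yu)

    attachments : ∀ {r a b} → a ∈ Comp G (N₂ G x) r → b ∈ Comp G (N₂ G x) r →
      Adj a b → (N G x ∩ NS G (Comp G (N₂ G x) r)) ≐ (N G x ∩ NS G (｛ a ｝ ∪ ｛ b ｝))
    attachments {r} {a} {b} r⇝a r⇝b ab = shrink , grow
      where
      a₂ = walk-target r⇝a
      b₂ = walk-target r⇝b

      edge⊆N₂ : ｛ a ｝ ∪ ｛ b ｝ ⊆ N₂ G x
      edge⊆N₂ (inj₁ refl) = a₂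
      edge⊆N₂ (inj₂ refl) = b₂

      shrink : N G x ∩ NS G (Comp G (N₂ G x) r) ⊆ N G x ∩ NS G (｛ a ｝ ∪ ｛ b ｝)
      shrink (xu , _ , c , r⇝c , cu)
        with cover b₂ (adj-sym ab) (comp-walk r⇝a r⇝c) (xu , cu)
      ... | inj₁ bu = attach x edge⊆N₂ xu (b , inj₂ refl , bu)
      ... | inj₂ au = attach x edge⊆N₂ xu (a , inj₁ refl , au)

      grow : N G x ∩ NS G (｛ a ｝ ∪ ｛ b ｝) ⊆ N G x ∩ NS G (Comp G (N₂ G x) r)
      grow (xu , _ , _ , inj₁ refl , su) = attach x walk-target xu (a , r⇝a , su)
      grow (xu , _ , _ , inj₂ refl , su) = attach x walk-target xu (b , r⇝b , su)

    -- For an edge a − b of a component A of G[N₂(x)] lying in H_x, the vertex a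
    -- has a neighbour in N(x) outside N(b): otherwise, by part (1), b would
    -- witness that A belongs to A*, and the root r of A would lie in N[V(A*)].
    undominated : ∀ {r a b} → r ∈ N₂ G x → r ∈ VH G x →
      a ∈ Comp G (N₂ G x) r → b ∈ Comp G (N₂ G x) r → Adj a b →
      Satisfiable ((N G a ∩ ∁ (N G b)) ∩ N G x)
    undominated {r} {a} {b} r₂ r∈H r⇝a r⇝b ab = private-neighbour x dominated-absurd
      where
      dominated-absurd : ¬ (N G x ∩ N G a ⊆ N G b)
      dominated-absurd a⊆b =
        proj₂ r∈H (inj₁ (r , (r₂ , b , r⇝b , witness) , here r₂))
        where
        onto-b : N G x ∩ NS G (｛ a ｝ ∪ ｛ b ｝) ⊆ N G x ∩ N G b
        onto-b (xu , _ , _ , inj₁ refl , au) = xu , a⊆b (xu , au)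
        onto-b (xu , _ , _ , inj₂ refl , bu) = xu , bu

        witness : (N G x ∩ N G b) ≐ (N G x ∩ NS G (Comp G (N₂ G x) r))
        witness = (λ (xu , bu) → attach x walk-target xu (b , r⇝b , bu))
                , (λ u∈NA → onto-b (proj₁ (attachments r⇝a r⇝b ab) u∈NA))

    -- Part (4), in general form: adjacent a, b in N₂(x) with private neighbours
    -- u ∈ N(a) ∖ N(b) and u′ ∈ N(b) ∖ N(a) in N(x) have no common neighbour w in
    -- N(x), since x, u, a, w, b, u′ would be a 6-cycle.
    no-common-neighbour : ∀ {a b} → a ∈ N₂ G x → b ∈ N₂ G x → Adj a b →
      Satisfiable ((N G a ∩ ∁ (N G b)) ∩ N G x) →
      Satisfiable ((N G b ∩ ∁ (N G a)) ∩ N G x) →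
      Empty (N G a ∩ N G b ∩ N G x)
    no-common-neighbour a₂ b₂ ab (u , (au , b≁u) , xu) (u′ , (bu′ , a≁u′) , xu′)
                        w (aw , bw , xw) =
      contradiction
        (six-cycle xu (adj-sym au) aw (adj-sym bw) bu′ (adj-sym xu′)
           (≢-sym (N₂-≢-root x a₂)) (adj⇒≢ xw) (≢-sym (N₂-≢-root x b₂))
           (λ { refl → b≁u bw }) (≢-sym (N₂-≢-N x b₂ xu)) (λ { refl → a≁u′ au })
           (adj⇒≢ ab) (N₂-≢-N x a₂ xu′) (λ { refl → a≁u′ aw }))
        c6-free

lemma7 : {n : ℕ} (G : Graph n) → C6Free G →
    (x r : V G) → r ∈ N₂ G x →
    (∀ v → v ∈ Comp G (N₂ G x) r → v ∈ VH G x) →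
    (a b : V G) → a ∈ Comp G (N₂ G x) r → b ∈ Comp G (N₂ G x) r → Graph.Adj G a b →
    ((N G x ∩ NS G (Comp G (N₂ G x) r)) ≐ (N G x ∩ NS G (｛ a ｝ ∪ ｛ b ｝)))
    × Satisfiable ((N G a ∩ ∁ (N G b)) ∩ N G x)
    × Satisfiable ((N G b ∩ ∁ (N G a)) ∩ N G x)
    × Empty (N G a ∩ N G b ∩ N G x)
lemma7 G c6-free x r r₂ A⊆H a b r⇝a r⇝b ab =
  attachments G c6-free x r⇝a r⇝b ab , a-private , b-private ,
  no-common-neighbour G c6-free x (walk-target G r⇝a) (walk-target G r⇝b) ab
                      a-private b-private
  where
  r∈H = A⊆H r (here r₂)
  a-private = undominated G c6-free x r₂ r∈H r⇝a r⇝b ab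
  b-private = undominated G c6-free x r₂ r∈H r⇝b r⇝a (Graph.sym G ab)
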